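{- Let $\alpha$ be an irrational real number. Then $B(\alpha)\leq 2$ and $B(2\alpha)\leq 2$ if and only if the continued fraction of $\alpha$ has one of the following two shapes, for some $n\geq 0$: (1) $\alpha=[a_0;a_1,\ldots,a_n,\overline{2}]$ with $q_n\equiv q_{n-1}\equiv 1\pmod 2$; (2) $\alpha=[a_0;a_1,\ldots,a_n,\overline{2,1}]$ with $q_{n-1}\equiv 0\pmod 2$.
   Context: For an irrational real $x=[a_0;a_1,a_2,\ldots]$, $B(x)=\limsup_{n\to\infty}a_n(x)$. For $\alpha=[a_0;a_1,a_2,\ldots]$, $q_n$ denotes the denominator of the $n$-th convergent $p_n/q_n=[a_0;a_1,\ldots,a_n]$, i.e. $q_{ -1}=0$, $q_0=1$, $q_{n+1}=a_{n+1}q_n+q_{n-1}$. $\overline{2}$ and $\overline{2,1}$ denote the blocks $2$ and $2,1$ repeated forever. -}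

module Defs where

open import Data.Nat using (ℕ; zero; suc) renaming (_+_ to _+ℕ_; _*_ to _*ℕ_; _≤_ to _≤ℕ_)
open import Data.Integer using (ℤ; +_; _+_; _*_; _≤_; _<_)
open import Data.Integer.Divisibility using (_∣_)
open import Data.Product using (_×_; _,_; proj₁; proj₂; ∃-syntax; Σ-syntax)
open import Relation.Binary.PropositionalEquality using (_≡_)
open import Relation.Nullary using (¬_)
open import Function.Bundles using (_⇔_)

-- A regular continued fraction [a 0; a 1, a 2, ...] of an irrational real:
-- a 0 ∈ ℤ arbitrary, a n ≥ 1 for n ≥ 1 (infinite, hence irrational).
IsCF : (ℕ → ℤ) → Set
IsCF a = ∀ n → + 1 ≤ a (suc n)

qPair : (ℕ → ℤ) → ℕ → ℤ × ℤ
qPair a zero = (+ 0 , + 1)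
qPair a (suc n) with qPair a n
... | (qm , qn) = (qn , a (suc n) * qn + qm)

pPair : (ℕ → ℤ) → ℕ → ℤ × ℤ
pPair a zero = (+ 1 , a 0)
pPair a (suc n) with pPair a n
... | (pm , pn) = (pn , a (suc n) * pn + pm)

-- q n = q_n ;  qPrev n = q_{n-1}  (so qPrev 0 = q_{-1} = 0)
q : (ℕ → ℤ) → ℕ → ℤ
q a n = proj₂ (qPair a n)

qPrev : (ℕ → ℤ) → ℕ → ℤ
qPrev a n = proj₁ (qPair a n)

p : (ℕ → ℤ) → ℕ → ℤ
p a n = proj₂ (pPair a n)

-- The rational m/d (d ≥ 1) lies strictly below the real value c · [a],
-- for c ∈ ℕ, c ≥ 1.  For an irrational CF value x, r < x iff r < p_{2k}/q_{2k}
-- for some k (even convergents increase to x).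
BelowScaled : ℕ → (ℕ → ℤ) → ℤ → ℕ → Set
BelowScaled c a m d = ∃[ k ] (m * q a (2 *ℕ k) < (+ c) * p a (2 *ℕ k) * (+ d))

-- "value of CF b equals c times value of CF a" (equality of Dedekind lower cuts)
ValueScaled : (ℕ → ℤ) → ℕ → (ℕ → ℤ) → Set
ValueScaled b c a = ∀ (m : ℤ) (d : ℕ) → 1 ≤ℕ d →
  (BelowScaled 1 b m d ⇔ BelowScaled c a m d)

-- B(x) ≤ c, i.e. limsup of the partial quotients ≤ c; for an integer-valued
-- sequence this is: eventually all partial quotients are ≤ c.
LimsupLe : (ℕ → ℤ) → ℤ → Set
LimsupLe a c = ∃[ N ] (∀ n → N ≤ℕ n → a n ≤ c)

Shape1 : (ℕ → ℤ) → ℕ → Set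
Shape1 a n = (∀ j → a (n +ℕ suc j) ≡ + 2)
           × ¬ (+ 2 ∣ q a n) × ¬ (+ 2 ∣ qPrev a n)

Shape2 : (ℕ → ℤ) → ℕ → Set
Shape2 a n = (∀ j → a (n +ℕ suc (2 *ℕ j)) ≡ + 2 × a (n +ℕ suc (suc (2 *ℕ j))) ≡ + 1)
           × (+ 2 ∣ qPrev a n)

module Submission where

-- Doubling a continued fraction is done by a transducer in the style of Gosper and Raney.  If
-- x and y are the tails of α and 2α still to be read and written, then y = M x for a Möbius map M
-- from a small family (2x, 2x + 1, (x + 1)/(x - 1), k + 2/x); reading one partial quotient of x
-- determines the next partial quotients of y and the next map.  Moreover the current map fixes
-- the parities of the last two denominators q.  Once all partial quotients of α and 2α are at most
-- 2, the only maps that can recur are (x + 1)/(x - 1), forcing α to end in 2, 2, 2, … with both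
-- denominators odd, and 2x, forcing α to end in 1, 2, 1, 2, … with the last denominator even;
-- conversely, from those states the transducer writes only 2s, respectively 2, 1, 2, 1, ….
-- Reals are never formed: u · [a] < v is read off the convergents of a.

open import Defs
open import Data.Bool.Base using (T)
open import Data.Empty using (⊥; ⊥-elim)
open import Data.Integer.Base as ℤ
  using (ℤ; +_; -[1+_]; _+_; _*_; _-_; -_; _≤_; _<_; +≤+; +<+; -≤+; -≤-; ∣_∣)
import Data.Integer.Properties as ℤ
open import Data.Integer.Divisibility using (_∣_; divides)
open import Data.Integer.Tactic.RingSolver using (solve-∀; solve)
open import Data.List.Base using (_∷_; [])
open import Data.Nat.Base as ℕ using (ℕ; zero; suc; z≤n; s≤s)
  renaming (_≤_ to _≤ℕ_; _<_ to _<ℕ_)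
open import Data.Nat.Induction using (<-rec)
import Data.Nat.Properties as ℕ
import Data.Nat.Tactic.RingSolver as ℕ-Solver
open import Data.Product using (∃-syntax; _×_; _,_; proj₁; proj₂)
open import Data.Sum using (_⊎_; inj₁; inj₂; [_,_]′)
open import Function.Bundles using (_⇔_; mk⇔; Equivalence)
open import Relation.Binary.PropositionalEquality
open import Relation.Nullary using (¬_; yes; no)

i<j⇒0<j-i : ∀ {i j} → i < j → + 0 < j - i
i<j⇒0<j-i {i} {j} h = subst (_< j - i) (ℤ.+-inverseʳ i) (ℤ.+-monoˡ-< (- i) h)

0<j-i⇒i<j : ∀ {i j} → + 0 < j - i → i < j
0<j-i⇒i<j {i} {j} h = subst₂ _<_ (ℤ.+-identityˡ i) (cancel i j) (ℤ.+-monoˡ-< i h)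
  where
  cancel : ∀ i j → j - i + i ≡ j
  cancel = solve-∀

≤-by-difference : ∀ {x y} d → d ≡ y - x → + 0 ≤ d → x ≤ y
≤-by-difference d refl h = ℤ.0≤i-j⇒j≤i h

<-by-difference : ∀ {x y} d → d ≡ y - x → + 0 < d → x < y
<-by-difference d refl h = 0<j-i⇒i<j h

nonNeg+nonNeg : ∀ {x y} → + 0 ≤ x → + 0 ≤ y → + 0 ≤ x + y
nonNeg+nonNeg (+≤+ _) (+≤+ _) = +≤+ z≤n

nonNeg*nonNeg : ∀ {x y} → + 0 ≤ x → + 0 ≤ y → + 0 ≤ x * y
nonNeg*nonNeg {+ m} {+ n} _ _ = subst (+ 0 ≤_) (ℤ.pos-* m n) (+≤+ z≤n)

pos+nonNeg : ∀ {x y} → + 0 < x → + 0 ≤ y → + 0 < x + y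
pos+nonNeg (+<+ (s≤s _)) (+≤+ _) = +<+ (s≤s z≤n)

pos*pos : ∀ {x y} → + 0 < x → + 0 < y → + 0 < x * y
pos*pos {+ suc m} {+ suc n} (+<+ (s≤s _)) (+<+ (s≤s _)) = +<+ (s≤s z≤n)

0<i*j⇒0<i : ∀ {i j} → + 0 < j → + 0 < i * j → + 0 < i
0<i*j⇒0<i {+ suc n} _ _ = +<+ (s≤s z≤n)
0<i*j⇒0<i {+ zero} {+ suc m} _ (+<+ ())
0<i*j⇒0<i { -[1+ n ]} {+ suc m} _ ()
0<i*j⇒0<i { -[1+ n ]} {+ zero} (+<+ ()) _

0<⇒+suc : ∀ {x} → + 0 < x → ∃[ n ] x ≡ + suc n
0<⇒+suc (+<+ (s≤s {n = n} _)) = n , refl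

i<1+j⇒i≤j : ∀ {i j} → i < ℤ.suc j → i ≤ j
i<1+j⇒i≤j {j = j} h = subst (_ ≤_) (ℤ.pred-suc j) (ℤ.i<j⇒i≤pred[j] h)

one-or-two : ∀ {x} → + 1 ≤ x → x ≤ + 2 → x ≡ + 1 ⊎ x ≡ + 2
one-or-two (+≤+ {n = 1} _) _ = inj₁ refl
one-or-two (+≤+ {n = 2} _) _ = inj₂ refl
one-or-two (+≤+ {n = suc (suc (suc _))} _) (+≤+ (s≤s (s≤s ())))

3≤⇒≰2 : ∀ {x} → + 3 ≤ x → ¬ x ≤ + 2
3≤⇒≰2 3≤x x≤2 with ℤ.≤-trans 3≤x x≤2
... | +≤+ (s≤s (s≤s ()))

Even Odd : ℤ → Set
Even x = ∃[ k ] x ≡ + 2 * k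
Odd x = ∃[ k ] x ≡ + 2 * k + + 1

even⇒¬odd : ∀ {x} → Even x → ¬ Odd x
even⇒¬odd (j , refl) (k , e) =
  ℕ.even≢odd ∣ j - k ∣ 0 (trans (sym (ℤ.abs-* (+ 2) (j - k))) (cong ∣_∣ twice-difference))
  where
  distrib : ∀ j k → + 2 * (j - k) ≡ + 2 * j - + 2 * k
  distrib = solve-∀
  cancel : ∀ k → + 2 * k + + 1 - + 2 * k ≡ + 1
  cancel = solve-∀
  twice-difference : + 2 * (j - k) ≡ + 1
  twice-difference = trans (distrib j k) (trans (cong (_- + 2 * k) e) (cancel k))

even⇒2∣ : ∀ {x} → Even x → + 2 ∣ x
even⇒2∣ (k , refl) = divides ∣ k ∣ (trans (ℤ.abs-* (+ 2) k) (ℕ.*-comm 2 ∣ k ∣))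

2∣⇒even : ∀ {x} → + 2 ∣ x → Even x
2∣⇒even {+ n} (divides m eq) = + m , trans (cong +_ (trans eq (ℕ.*-comm m 2))) (ℤ.pos-* 2 m)
2∣⇒even { -[1+ n ]} (divides m eq) = - + m , (begin
  - + suc n      ≡⟨ cong (λ z → - + z) (trans eq (ℕ.*-comm m 2)) ⟩
  - + (2 ℕ.* m)  ≡⟨ cong -_ (ℤ.pos-* 2 m) ⟩
  - (+ 2 * + m)  ≡⟨ ℤ.neg-distribʳ-* (+ 2) (+ m) ⟩
  + 2 * - + m    ∎)
  where open ≡-Reasoning

odd⇒¬2∣ : ∀ {x} → Odd x → ¬ + 2 ∣ x
odd⇒¬2∣ o d = even⇒¬odd (2∣⇒even d) o

module _ {A Q Q' : ℤ} where

  any*even+odd : Even Q → Odd Q' → Odd (A * Q + Q')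
  any*even+odd (k , refl) (l , refl) = A * k + l , solve (A ∷ k ∷ l ∷ [])

  odd*odd+even : Odd A → Odd Q → Even Q' → Odd (A * Q + Q')
  odd*odd+even (c , refl) (k , refl) (l , refl) = + 2 * c * k + c + k + l , solve (c ∷ k ∷ l ∷ [])

  even*odd+even : Even A → Odd Q → Even Q' → Even (A * Q + Q')
  even*odd+even (c , refl) (k , refl) (l , refl) = + 2 * c * k + c + l , solve (c ∷ k ∷ l ∷ [])

  odd*odd+odd : Odd A → Odd Q → Odd Q' → Even (A * Q + Q')
  odd*odd+odd (c , refl) (k , refl) (l , refl) = + 2 * c * k + c + k + l + + 1 , solve (c ∷ k ∷ l ∷ [])

  even*odd+odd : Even A → Odd Q → Odd Q' → Odd (A * Q + Q')
  even*odd+odd (c , refl) (k , refl) (l , refl) = + 2 * c * k + c + l , solve (c ∷ k ∷ l ∷ [])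

-- Convergents

tail : (ℕ → ℤ) → ℕ → ℤ
tail a n = a (suc n)

drop : ℕ → (ℕ → ℤ) → ℕ → ℤ
drop zero a = a
drop (suc i) a = tail (drop i a)

drop-apply : ∀ i a n → drop i a n ≡ a (i ℕ.+ n)
drop-apply zero a n = refl
drop-apply (suc i) a n = trans (drop-apply i a (suc n)) (cong a (ℕ.+-suc i n))

drop-head : ∀ i a → drop i a 0 ≡ a i
drop-head i a = trans (drop-apply i a 0) (cong a (ℕ.+-identityʳ i))

IsCF-tail : ∀ {a} → IsCF a → IsCF (tail a)
IsCF-tail h n = h (suc n)

IsCF-drop : ∀ {a} i → IsCF a → IsCF (drop i a)
IsCF-drop zero h = h
IsCF-drop {a} (suc i) h = IsCF-tail {drop i a} (IsCF-drop i h)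

pPrev : (ℕ → ℤ) → ℕ → ℤ
pPrev a n = proj₁ (pPair a n)

recurrence : ℤ → ℤ × ℤ → ℤ × ℤ
recurrence x (m , n) = n , x * n + m

combine : ℤ → ℤ × ℤ → ℤ × ℤ → ℤ × ℤ
combine c (pm , pn) (qm , qn) = c * pm + qm , c * pn + qn

recurrence-combine : ∀ x c P Q → recurrence x (combine c P Q) ≡ combine c (recurrence x P) (recurrence x Q)
recurrence-combine x c (pm , pn) (qm , qn) = cong (c * pn + qn ,_) (lemma x c pm pn qm qn)
  where
  lemma : ∀ x c pm pn qm qn → x * (c * pn + qn) + (c * pm + qm) ≡ c * (x * pn + pm) + (x * qn + qm)
  lemma = solve-∀

qPair-tail : ∀ a k → qPair a (suc k) ≡ pPair (tail a) k
qPair-tail a zero = cong (+ 1 ,_) (lemma (a 1))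
  where
  lemma : ∀ x → x * + 1 + + 0 ≡ x
  lemma = solve-∀
qPair-tail a (suc k) = cong (recurrence (a (suc (suc k)))) (qPair-tail a k)

pPair-tail : ∀ a k → pPair a (suc k) ≡ combine (a 0) (pPair (tail a) k) (qPair (tail a) k)
pPair-tail a zero = cong₂ _,_ (lemma₁ (a 0)) (lemma₂ (a 0) (a 1))
  where
  lemma₁ : ∀ x → x ≡ x * + 1 + + 0
  lemma₁ = solve-∀
  lemma₂ : ∀ x y → y * x + + 1 ≡ x * y + + 1
  lemma₂ = solve-∀
pPair-tail a (suc k) = trans (cong (recurrence (a (suc (suc k)))) (pPair-tail a k)) 
  (recurrence-combine (a (suc (suc k))) (a 0) (pPair (tail a) k) (qPair (tail a) k))

p-tail : ∀ a k → p a (suc k) ≡ a 0 * p (tail a) k + q (tail a) k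
p-tail a k = cong proj₂ (pPair-tail a k)

q-tail : ∀ a k → q a (suc k) ≡ p (tail a) k
q-tail a k = cong proj₂ (qPair-tail a k)

q-pos : ∀ {a} → IsCF a → ∀ k → + 0 < q a k
q-pos {a} h k = proj₂ (invariant k)
  where
  invariant : ∀ k → + 0 ≤ qPrev a k × + 0 < q a k
  invariant zero = +≤+ z≤n , +<+ (s≤s z≤n)
  invariant (suc k) with invariant k
  ... | qPrev≥0 , q>0 = ℤ.<⇒≤ q>0 , pos+nonNeg (pos*pos (ℤ.suc[i]≤j⇒i<j (h k)) q>0) qPrev≥0

determinant : (ℕ → ℤ) → ℕ → ℤ
determinant a k = p a k * qPrev a k - pPrev a k * q a k

determinant-suc : ∀ a k → determinant a (suc k) ≡ - determinant a k
determinant-suc a k = lemma (a (suc k)) (p a k) (pPrev a k) (q a k) (qPrev a k)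
  where
  lemma : ∀ x P P' Q Q' → (x * P + P') * Q - P * (x * Q + Q') ≡ - (P * Q' - P' * Q)
  lemma = solve-∀

double : ℕ → ℕ
double zero = zero
double (suc k) = suc (suc (double k))

double≡2* : ∀ k → double k ≡ 2 ℕ.* k
double≡2* zero = refl
double≡2* (suc k) = cong suc (trans (cong suc (double≡2* k)) (sym (ℕ.+-suc k (k ℕ.+ 0))))

double-ℤ : ∀ k → + double k ≡ + 2 * + k
double-ℤ k = trans (cong +_ (double≡2* k)) (ℤ.pos-* 2 k)

half : ∀ n → ∃[ t ] (n ≡ double t ⊎ n ≡ suc (double t))
half zero = 0 , inj₁ refl
half (suc n) with half n
... | t , inj₁ n≡2t = t , inj₂ (cong suc n≡2t)
... | t , inj₂ n≡1+2t = suc t , inj₁ (cong suc n≡1+2t)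

determinant-even : ∀ a k → determinant a (double k) ≡ - + 1
determinant-even a zero = lemma (a 0)
  where
  lemma : ∀ x → x * + 0 - + 1 * + 1 ≡ - + 1
  lemma = solve-∀
determinant-even a (suc k) = begin
  determinant a (suc (suc (double k)))  ≡⟨ determinant-suc a _ ⟩
  - determinant a (suc (double k))      ≡⟨ cong -_ (determinant-suc a _) ⟩
  - - determinant a (double k)          ≡⟨ ℤ.neg-involutive _ ⟩
  determinant a (double k)              ≡⟨ determinant-even a k ⟩
  - + 1                                 ∎
  where open ≡-Reasoning

even-convergent-below : ∀ {a} → IsCF a → ∀ k j → double k ≤ℕ j →
  + 0 ≤ p a j * q a (double k) - p a (double k) * q a j
even-convergent-below {a} h k j n≤j =
  subst (λ i → + 0 ≤ gap i) (ℕ.m∸n+n≡m n≤j) (proj₁ (invariant (j ℕ.∸ n)))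
  where
  n = double k
  -- gap i satisfies the recurrence of the convergents, starting from gap n = 0 and gap (n + 1) = 1.
  gap : ℕ → ℤ
  gap i = p a i * q a n - p a n * q a i
  gap-self : ∀ P Q → P * Q - P * Q ≡ + 0
  gap-self = solve-∀
  gap-next : ∀ x P P' Q Q' Pn Qn →
    (x * P + P') * Qn - Pn * (x * Q + Q') ≡ x * (P * Qn - Pn * Q) + (P' * Qn - Pn * Q')
  gap-next = solve-∀
  invariant : ∀ t → + 0 ≤ gap (t ℕ.+ n) × + 0 ≤ gap (suc t ℕ.+ n)
  invariant zero = subst (+ 0 ≤_) (sym (gap-self (p a n) (q a n))) (+≤+ z≤n) ,
                   subst (+ 0 ≤_) (sym (trans (determinant-suc a n) (cong -_ (determinant-even a k)))) (+≤+ z≤n)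
  invariant (suc t) with invariant t
  ... | gap₀ , gap₁ = gap₁ , subst (+ 0 ≤_) (sym (gap-next (a (suc (suc m))) _ _ _ _ (p a n) (q a n)))
                               (nonNeg+nonNeg (nonNeg*nonNeg (ℤ.≤-trans (+≤+ z≤n) (h (suc m))) gap₁) gap₀)
    where m = t ℕ.+ n

-- Comparing the value of a continued fraction with rationals

-- u ·⟦ a ⟧< v  encodes  u · [a] < v : the convergents p k / q k tend to the irrational
-- value [a], so this holds iff u · p k < v · q k for all large k.
infix 4 _·⟦_⟧<_
record _·⟦_⟧<_ (u : ℤ) (a : ℕ → ℤ) (v : ℤ) : Set where
  constructor eventually
  field
    threshold : ℕ
    holds     : ∀ k → threshold ≤ℕ k → u * p a k < v * q a k

·⟦⟧<-cong : ∀ {a u v u' v'} → u ≡ u' → v ≡ v' → u ·⟦ a ⟧< v → u' ·⟦ a ⟧< v'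
·⟦⟧<-cong refl refl h = h

<-translate : ∀ {L R L' R'} W → L + W ≡ L' → R + W ≡ R' → L < R → L' < R'
<-translate W refl refl h = ℤ.+-monoˡ-< W h

·⟦⟧<-tail⁺ : ∀ {a u v} → u ·⟦ a ⟧< v → (u * a 0 - v) ·⟦ tail a ⟧< - u
·⟦⟧<-tail⁺ {a} {u} {v} (eventually N h) = eventually N λ k N≤k →
  <-translate (- (u * q (tail a) k) - v * p (tail a) k) (left u v (a 0) _ _) (right u v _ _)
    (subst₂ _<_ (cong (u *_) (p-tail a k)) (cong (v *_) (q-tail a k)) (h (suc k) (ℕ.m≤n⇒m≤1+n N≤k)))
  where
  left : ∀ u v x P Q → u * (x * P + Q) + (- (u * Q) - v * P) ≡ (u * x - v) * P
  left = solve-∀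
  right : ∀ u v P Q → v * P + (- (u * Q) - v * P) ≡ - u * Q
  right = solve-∀

·⟦⟧<-tail⁻ : ∀ {a u v} → (u * a 0 - v) ·⟦ tail a ⟧< - u → u ·⟦ a ⟧< v
·⟦⟧<-tail⁻ {a} {u} {v} (eventually N h) = eventually (suc N) holds
  where
  left : ∀ u v x P Q → (u * x - v) * P + (u * Q + v * P) ≡ u * (x * P + Q)
  left = solve-∀
  right : ∀ u v P Q → - u * Q + (u * Q + v * P) ≡ v * P
  right = solve-∀
  holds : ∀ k → suc N ≤ℕ k → u * p a k < v * q a k
  holds (suc k) (s≤s N≤k) = subst₂ _<_ (cong (u *_) (sym (p-tail a k))) (cong (v *_) (sym (q-tail a k)))
    (<-translate (u * q (tail a) k + v * p (tail a) k) (left u v (a 0) _ _) (right u v _ _) (h k N≤k))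

0·⟦⟧< : ∀ {a v} → IsCF a → + 0 < v → + 0 ·⟦ a ⟧< v
0·⟦⟧< {a} {v} h v>0 = eventually 0 λ k _ →
  subst (_< v * q a k) (sym (ℤ.*-zeroˡ (p a k))) (pos*pos v>0 (q-pos {a} h k))

0·⟦⟧<⁻¹ : ∀ {a v} → IsCF a → + 0 ·⟦ a ⟧< v → + 0 < v
0·⟦⟧<⁻¹ {a} {v} h (eventually N g) =
  0<i*j⇒0<i (q-pos {a} h N) (subst (_< v * q a N) (ℤ.*-zeroˡ (p a N)) (g N ℕ.≤-refl))

·⟦⟧<-common : ∀ {a u v u' v'} → u ·⟦ a ⟧< v → u' ·⟦ a ⟧< v' →
  ∃[ k ] (u * p a k < v * q a k × u' * p a k < v' * q a k)
·⟦⟧<-common (eventually N g) (eventually M h) = N ℕ.⊔ M , g _ (ℕ.m≤m⊔n N M) , h _ (ℕ.m≤n⊔m N M)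

·⟦⟧<-asym : ∀ {a u v} → u ·⟦ a ⟧< v → (- u) ·⟦ a ⟧< - v → ⊥
·⟦⟧<-asym {a} {u} {v} h h' with ·⟦⟧<-common h h'
... | k , lt , lt' = ℤ.<-irrefl refl (subst₂ _<_ (cancel u _) (cancel v _) (ℤ.+-mono-< lt lt'))
  where
  cancel : ∀ u P → u * P + - u * P ≡ + 0
  cancel = solve-∀

·⟦⟧<-scale : ∀ {a u v} c → u ·⟦ a ⟧< v → (+ suc c * u) ·⟦ a ⟧< (+ suc c * v)
·⟦⟧<-scale {a} {u} {v} c (eventually N g) = eventually N λ k N≤k →
  subst₂ _<_ (assoc (+ suc c) u _) (assoc (+ suc c) v _) (ℤ.*-monoˡ-<-pos (+ suc c) (g k N≤k))
  where
  assoc : ∀ c u P → c * (u * P) ≡ (c * u) * P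
  assoc = solve-∀

·⟦⟧<-weaken : ∀ {a u v v'} → IsCF a → u ·⟦ a ⟧< v → v ≤ v' → u ·⟦ a ⟧< v'
·⟦⟧<-weaken {a} {u} {v} {v'} h (eventually N g) v≤v' = eventually N λ k N≤k →
  ℤ.<-≤-trans (g k N≤k)
    (≤-by-difference _ (distrib v v' _) (nonNeg*nonNeg (ℤ.i≤j⇒0≤j-i v≤v') (ℤ.<⇒≤ (q-pos h k))))
  where
  distrib : ∀ v v' Q → (v' - v) * Q ≡ v' * Q - v * Q
  distrib = solve-∀

head<value : ∀ {a} → IsCF a → (- + 1) ·⟦ a ⟧< - a 0
head<value {a} h =
  ·⟦⟧<-tail⁻ (·⟦⟧<-cong (zero-coefficient (a 0)) refl (0·⟦⟧< (IsCF-tail {a} h) (+<+ (s≤s z≤n))))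
  where
  zero-coefficient : ∀ x → + 0 ≡ (- + 1) * x - (- x)
  zero-coefficient = solve-∀

one<value : ∀ {a} → IsCF a → + 1 ≤ a 0 → (- + 1) ·⟦ a ⟧< - + 1
one<value h 1≤a₀ = ·⟦⟧<-weaken h (head<value h) (ℤ.neg-mono-≤ 1≤a₀)

value<head+1 : ∀ {a} → IsCF a → + 1 ·⟦ a ⟧< a 0 + + 1
value<head+1 {a} h =
  ·⟦⟧<-tail⁻ (·⟦⟧<-cong (sym (coefficient (a 0))) refl (one<value (IsCF-tail {a} h) (h 0)))
  where
  coefficient : ∀ x → + 1 * x - (x + + 1) ≡ - + 1
  coefficient = solve-∀

-- Sufficient conditions for U · x < V at every x > 1, stated through equations so that
-- U and V can be given as unsimplified expressions.
data Bound>1 (U V : ℤ) : Set where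
  negative    : ∀ m w → U ≡ -[1+ m ] → V ≡ w → -[1+ m ] ≤ w → Bound>1 U V
  zero        : ∀ n → U ≡ + 0 → V ≡ + suc n → Bound>1 U V
  nonPositive : ∀ W → U ≡ W → V ≡ + 1 → W ≤ + 0 → Bound>1 U V

Bound>1⇒·⟦⟧< : ∀ {a U V} → IsCF a → + 1 ≤ a 0 → Bound>1 U V → U ·⟦ a ⟧< V
Bound>1⇒·⟦⟧< h 1≤a₀ (negative m w refl refl U≤V) =
  ·⟦⟧<-weaken h (·⟦⟧<-cong (negate m) (negate m) (·⟦⟧<-scale m (one<value h 1≤a₀))) U≤V
  where
  negate : ∀ m → + suc m * - + 1 ≡ -[1+ m ]
  negate m = trans (ℤ.*-comm (+ suc m) (- + 1)) (ℤ.-1*i≡-i (+ suc m))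
Bound>1⇒·⟦⟧< h 1≤a₀ (zero n refl refl) = 0·⟦⟧< h (+<+ (s≤s z≤n))
Bound>1⇒·⟦⟧< h 1≤a₀ (nonPositive -[1+ m ] refl refl _) =
  Bound>1⇒·⟦⟧< h 1≤a₀ (negative m (+ 1) refl refl -≤+)
Bound>1⇒·⟦⟧< h 1≤a₀ (nonPositive (+ zero) refl refl _) = Bound>1⇒·⟦⟧< h 1≤a₀ (zero 0 refl refl)
Bound>1⇒·⟦⟧< h 1≤a₀ (nonPositive (+ suc n) refl refl (+≤+ ()))

below-above⇒< : ∀ {b r s} → IsCF b → + 1 ·⟦ b ⟧< s → (- + 1) ·⟦ b ⟧< - r → r < s
below-above⇒< {b} {r} {s} h below above with ·⟦⟧<-common below above
... | k , lt , lt' = 0<j-i⇒i<j (0<i*j⇒0<i (q-pos h k)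
        (subst (+ 0 <_) (sum s r _ _) (pos+nonNeg (i<j⇒0<j-i lt) (ℤ.<⇒≤ (i<j⇒0<j-i lt')))))
  where
  sum : ∀ s r P Q → (s * Q - + 1 * P) + ((- r) * Q - (- + 1) * P) ≡ (s - r) * Q
  sum = solve-∀

head-from-bounds : ∀ {b t} → IsCF b → (- + 1) ·⟦ b ⟧< - t → + 1 ·⟦ b ⟧< t + + 1 → b 0 ≡ t
head-from-bounds {b} {t} h t<b b<t+1 = ℤ.≤-antisym
  (i<1+j⇒i≤j (subst (b 0 <_) (ℤ.+-comm t (+ 1)) (below-above⇒< h b<t+1 (head<value h))))
  (i<1+j⇒i≤j (subst (t <_) (ℤ.+-comm (b 0) (+ 1)) (below-above⇒< h (value<head+1 h) t<b)))

-- Since [a] is irrational, u · [a] ≠ v.  The proof runs the Euclidean algorithm on (u , v) along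
-- the digits of a: unless the first digit already decides the comparison, it passes to the tail
-- with the smaller coefficient v - u · a 0 ∈ (0 , u).
·⟦⟧<-dichotomy : ∀ {a} → IsCF a → ∀ n v → (+ suc n) ·⟦ a ⟧< v ⊎ (- + suc n) ·⟦ a ⟧< - v
·⟦⟧<-dichotomy {a} h n = <-rec Dichotomy descend n a h
  where
  Dichotomy : ℕ → Set
  Dichotomy n = ∀ a → IsCF a → ∀ v → (+ suc n) ·⟦ a ⟧< v ⊎ (- + suc n) ·⟦ a ⟧< - v
  scale-right : ∀ u → u * + 1 ≡ u
  scale-right = solve-∀
  scale-left : ∀ u → u * - + 1 ≡ - u
  scale-left = solve-∀
  scale-head : ∀ u x → u * - x ≡ - (u * x)
  scale-head = solve-∀
  descend : ∀ n → (∀ {m} → m <ℕ n → Dichotomy m) → Dichotomy n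
  descend n smaller a h v with (+ suc n * (a 0 + + 1)) ℤ.≤? v
  ... | yes u[a₀+1]≤v = inj₁ (·⟦⟧<-weaken h
          (·⟦⟧<-cong (scale-right (+ suc n)) refl (·⟦⟧<-scale n (value<head+1 h))) u[a₀+1]≤v)
  ... | no u[a₀+1]≰v with v ℤ.≤? (+ suc n * a 0)
  ...   | yes v≤ua₀ = inj₂ (·⟦⟧<-weaken h
            (·⟦⟧<-cong (scale-left (+ suc n)) (scale-head (+ suc n) (a 0)) (·⟦⟧<-scale n (head<value h)))
            (ℤ.neg-mono-≤ v≤ua₀))
  ...   | no v≰ua₀ with 0<⇒+suc (i<j⇒0<j-i (ℤ.≰⇒> v≰ua₀))
  ...     | n' , s≡1+n' = on-tail (smaller n'<n (tail a) (IsCF-tail {a} h) u)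
    where
    u = + suc n
    s = v - u * a 0
    remainder : ∀ u x v → u * (x + + 1) - v ≡ u - (v - u * x)
    remainder = solve-∀
    s<u : s < u
    s<u = 0<j-i⇒i<j (subst (+ 0 <_) (remainder u (a 0) v) (i<j⇒0<j-i (ℤ.≰⇒> u[a₀+1]≰v)))
    n'<n : n' <ℕ n
    n'<n = ℕ.s≤s⁻¹ (ℤ.drop‿+<+ (subst (_< u) s≡1+n' s<u))
    negated : ∀ u x v → v - u * x ≡ (- u) * x - (- v)
    negated = solve-∀
    flipped : ∀ u x v → - (v - u * x) ≡ u * x - v
    flipped = solve-∀
    on-tail : (+ suc n') ·⟦ tail a ⟧< u ⊎ (- + suc n') ·⟦ tail a ⟧< - u →
      u ·⟦ a ⟧< v ⊎ (- u) ·⟦ a ⟧< - v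
    on-tail (inj₁ r) =
      inj₂ (·⟦⟧<-tail⁻ (·⟦⟧<-cong (trans (sym s≡1+n') (negated u (a 0) v)) (sym (ℤ.neg-involutive u)) r))
    on-tail (inj₂ r) =
      inj₁ (·⟦⟧<-tail⁻ (·⟦⟧<-cong (trans (cong -_ (sym s≡1+n')) (flipped u (a 0) v)) refl r))

·⟦⟧<⇒BelowScaled : ∀ {a} c m d → (- (+ c * + d)) ·⟦ a ⟧< - m → BelowScaled c a m d
·⟦⟧<⇒BelowScaled {a} c m d (eventually N g) =
  N , ℤ.neg-cancel-< (subst₂ _<_ (left (+ c) (+ d) _) (right m _) (g (2 ℕ.* N) (ℕ.m≤n*m N 2)))
  where
  left : ∀ c d P → (- (c * d)) * P ≡ - (c * P * d)
  left = solve-∀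
  right : ∀ m Q → (- m) * Q ≡ - (m * Q)
  right = solve-∀

-- The even convergent witnessing m / d < c · [a] stays below all later convergents.
BelowScaled⇒·⟦⟧< : ∀ {a} c m d → IsCF a → BelowScaled c a m d → (- (+ c * + d)) ·⟦ a ⟧< - m
BelowScaled⇒·⟦⟧< {a} c m d h (k , below) = eventually (2 ℕ.* k) holds
  where
  n = double k
  C = + c * + d
  regroup : ∀ c d P m Q → c * P * d - m * Q ≡ (c * d) * P - m * Q
  regroup = solve-∀
  sum : ∀ C m Pn Qn Pj Qj → Qj * (C * Pn - m * Qn) + C * (Pj * Qn - Pn * Qj) ≡ (C * Pj - m * Qj) * Qn
  sum = solve-∀
  negated : ∀ C m P Q → C * P - m * Q ≡ (- m) * Q - (- C) * P
  negated = solve-∀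
  gap-at-n : + 0 < C * p a n - m * q a n
  gap-at-n = subst (+ 0 <_)
    (trans (cong (λ i → + c * p a i * + d - m * q a i) (sym (double≡2* k))) (regroup (+ c) (+ d) _ m _))
    (i<j⇒0<j-i below)
  holds : ∀ j → 2 ℕ.* k ≤ℕ j → (- C) * p a j < (- m) * q a j
  holds j 2k≤j = <-by-difference _ (negated C m _ _) (0<i*j⇒0<i (q-pos h n)
    (subst (+ 0 <_) (sum C m _ _ _ _)
      (pos+nonNeg (pos*pos (q-pos h j) gap-at-n)
        (nonNeg*nonNeg (nonNeg*nonNeg {+ c} {+ d} (+≤+ z≤n) (+≤+ z≤n))
          (even-convergent-below {a} h k j (subst (_≤ℕ j) (sym (double≡2* k)) 2k≤j))))))

-- Möbius maps and the doubling transducer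

-- Without eta, unifying möbius A B C D with consume d M or emit t M computes the latter, so the
-- ring solver sees its entries rather than projections.
record Möbius : Set where
  no-eta-equality
  pattern
  constructor möbius
  field
    A B C D : ℤ

consume : ℤ → Möbius → Möbius
consume d (möbius A B C D) = möbius (A * d + B) A (C * d + D) C

emit : ℤ → Möbius → Möbius
emit t (möbius A B C D) = möbius C D (A - t * C) (B - t * D)

-- x ↦⟨ M ⟩ y  states [y] = (A [x] + B) / (C [x] + D) through the comparisons with [y] it yields;
-- consume and emit rewrite M as a digit of x is read or a digit of y is written.
infix 4 _↦⟨_⟩_
record _↦⟨_⟩_ (x : ℕ → ℤ) (M : Möbius) (y : ℕ → ℤ) : Set where
  constructor maps
  open Möbius M
  field
    compare : ∀ u v → (u * A - v * C) ·⟦ x ⟧< (v * D - u * B) → u ·⟦ y ⟧< v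

↦-cast : ∀ {x y A B C D A' B' C' D'} → x ↦⟨ möbius A B C D ⟩ y →
  A ≡ A' → B ≡ B' → C ≡ C' → D ≡ D' → x ↦⟨ möbius A' B' C' D' ⟩ y
↦-cast R refl refl refl refl = R

↦-consume : ∀ {x M y} → x ↦⟨ M ⟩ y → tail x ↦⟨ consume (x 0) M ⟩ y
↦-consume {x} {möbius A B C D} (maps compare) = maps λ u v below →
  compare u v (·⟦⟧<-tail⁻ (·⟦⟧<-cong (left u v A B C D (x 0)) (right u v A C) below))
  where
  left : ∀ u v A B C D d → u * (A * d + B) - v * (C * d + D) ≡ (u * A - v * C) * d - (v * D - u * B)
  left = solve-∀
  right : ∀ u v A C → v * C - u * A ≡ - (u * A - v * C)
  right = solve-∀

↦-emit : ∀ {x M y t} → x ↦⟨ M ⟩ y → y 0 ≡ t → x ↦⟨ emit t M ⟩ tail y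
↦-emit {M = möbius A B C D} {t = t} (maps compare) refl = maps λ u v below →
  ·⟦⟧<-cong (new-u u v t) (ℤ.neg-involutive v)
    (·⟦⟧<-tail⁺ (compare (- v) (- (v * t) - u) (·⟦⟧<-cong (left u v t A C) (right u v t B D) below)))
  where
  left : ∀ u v t A C → u * C - v * (A - t * C) ≡ (- v) * A - (- (v * t) - u) * C
  left = solve-∀
  right : ∀ u v t B D → v * (B - t * D) - u * D ≡ (- (v * t) - u) * D - (- v) * B
  right = solve-∀
  new-u : ∀ u v t → (- v) * t - (- (v * t) - u) ≡ u
  new-u = solve-∀

-- The two bounds say t < [y] < t + 1, hence y 0 ≡ t.
↦-output : ∀ {x y A B C D} t → IsCF x → + 1 ≤ x 0 → IsCF y → x ↦⟨ möbius A B C D ⟩ y →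
  Bound>1 (t * C - A) (B - t * D) → Bound>1 (A - (t + + 1) * C) ((t + + 1) * D - B) →
  y 0 ≡ t × x ↦⟨ emit t (möbius A B C D) ⟩ tail y
↦-output {x} {y} {A} {B} {C} {D} t hx 1≤x₀ hy R@(maps compare) lower upper = y₀≡t , ↦-emit R y₀≡t
  where
  lower-U : ∀ t A C → t * C - A ≡ (- + 1) * A - (- t) * C
  lower-U = solve-∀
  lower-V : ∀ t B D → B - t * D ≡ (- t) * D - (- + 1) * B
  lower-V = solve-∀
  upper-U : ∀ t A C → A - (t + + 1) * C ≡ + 1 * A - (t + + 1) * C
  upper-U = solve-∀
  upper-V : ∀ t B D → (t + + 1) * D - B ≡ (t + + 1) * D - + 1 * B
  upper-V = solve-∀
  y₀≡t : y 0 ≡ t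
  y₀≡t = head-from-bounds hy
    (compare (- + 1) (- t)
      (Bound>1⇒·⟦⟧< hx 1≤x₀ (subst₂ Bound>1 (lower-U t A C) (lower-V t B D) lower)))
    (compare (+ 1) (t + + 1)
      (Bound>1⇒·⟦⟧< hx 1≤x₀ (subst₂ Bound>1 (upper-U t A C) (upper-V t B D) upper)))

data State : Set where
  twice twice+1 cayley : State
  offset : ℤ → State

matrix : State → Möbius
matrix twice      = möbius (+ 2) (+ 0) (+ 0) (+ 1)
matrix twice+1    = möbius (+ 2) (+ 1) (+ 0) (+ 1)
matrix cayley     = möbius (+ 1) (+ 1) (+ 1) (- + 1)
matrix (offset k) = möbius k (+ 2) (+ 1) (+ 0)

halving : ℤ → Möbius
halving m = möbius m (+ 1) (+ 2) (+ 0)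

twice-read : ∀ {x y} → x ↦⟨ matrix twice ⟩ y → tail x ↦⟨ matrix (offset (+ 2 * x 0)) ⟩ y
twice-read {x} {y} R =
  subst (λ k → tail x ↦⟨ matrix (offset k) ⟩ y) (ℤ.+-identityʳ (+ 2 * x 0)) (↦-consume R)

twice+1-read : ∀ {x y} → x ↦⟨ matrix twice+1 ⟩ y → tail x ↦⟨ matrix (offset (+ 2 * x 0 + + 1)) ⟩ y
twice+1-read = ↦-consume

offset-read-1 : ∀ {x y} k → IsCF x → IsCF y → x ↦⟨ matrix (offset k) ⟩ y → x 0 ≡ + 1 →
  y 0 ≡ k + + 1 × tail x ↦⟨ matrix cayley ⟩ tail y
offset-read-1 {x} {y} k hx hy R x₀≡1 = proj₁ out ,
  ↦-cast (proj₂ out) refl refl (solve (k ∷ [])) (solve (k ∷ []))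
  where
  R' : tail x ↦⟨ möbius (k * + 1 + + 2) k (+ 1) (+ 1) ⟩ y
  R' = subst (λ d → tail x ↦⟨ consume d (matrix (offset k)) ⟩ y) x₀≡1 (↦-consume R)
  out = ↦-output (k + + 1) (IsCF-tail {x} hx) (hx 0) hy R'
          (negative 0 (- + 1) (solve (k ∷ [])) (solve (k ∷ [])) ℤ.≤-refl)
          (zero 1 (solve (k ∷ [])) (solve (k ∷ [])))

offset-read-big : ∀ {x y} k → IsCF x → IsCF y → x ↦⟨ matrix (offset k) ⟩ y → + 2 ≤ x 0 →
  y 0 ≡ k × tail x ↦⟨ halving (x 0) ⟩ tail y
offset-read-big {x} {y} k hx hy R = read (x 0) (↦-consume R)
  where
  read : ∀ d → tail x ↦⟨ consume d (matrix (offset k)) ⟩ y → + 2 ≤ d →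
    y 0 ≡ k × tail x ↦⟨ halving d ⟩ tail y
  read d R' 2≤d = proj₁ out ,
    ↦-cast (proj₂ out) (solve (d ∷ [])) refl (solve (k ∷ d ∷ [])) (solve (k ∷ []))
    where
    out = ↦-output k (IsCF-tail {x} hx) (hx 0) hy R'
            (negative 1 (+ 0) (solve (k ∷ d ∷ [])) (solve (k ∷ [])) -≤+)
            (nonPositive (+ 2 - d) (solve (k ∷ d ∷ [])) (solve (k ∷ [])) (ℤ.i≤j⇒i-j≤0 2≤d))

halving-even : ∀ {x y} c → IsCF x → + 1 ≤ x 0 → IsCF y → x ↦⟨ halving (+ 2 * c) ⟩ y →
  y 0 ≡ c × x ↦⟨ matrix twice ⟩ tail y
halving-even {x} {y} c hx 1≤x₀ hy R = proj₁ out ,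
  ↦-cast (proj₂ out) refl refl (solve (c ∷ [])) (solve (c ∷ []))
  where
  out = ↦-output c hx 1≤x₀ hy R
          (zero 0 (solve (c ∷ [])) (solve (c ∷ [])))
          (negative 1 (- + 1) (solve (c ∷ [])) (solve (c ∷ [])) (-≤- z≤n))

halving-odd : ∀ {x y} c → IsCF x → + 1 ≤ x 0 → IsCF y → x ↦⟨ halving (+ 2 * c + + 1) ⟩ y →
  y 0 ≡ c × y 1 ≡ + 1 × x ↦⟨ matrix cayley ⟩ tail (tail y)
halving-odd {x} {y} c hx 1≤x₀ hy R = proj₁ out , out' 
  where
  out = ↦-output c hx 1≤x₀ hy R
          (negative 0 (+ 1) (solve (c ∷ [])) (solve (c ∷ [])) -≤+)
          (negative 0 (- + 1) (solve (c ∷ [])) (solve (c ∷ [])) ℤ.≤-refl)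
  R' : x ↦⟨ möbius (+ 2) (+ 0) (+ 1) (+ 1) ⟩ tail y
  R' = ↦-cast (proj₂ out) refl refl (solve (c ∷ [])) (solve (c ∷ []))
  out' = ↦-output (+ 1) hx 1≤x₀ (IsCF-tail {y} hy) R'
           (negative 0 (- + 1) refl refl ℤ.≤-refl) (zero 1 refl refl)

cayley-read-1 : ∀ {x y} → x ↦⟨ matrix cayley ⟩ y → x 0 ≡ + 1 → tail x ↦⟨ matrix twice+1 ⟩ y
cayley-read-1 {x} {y} R x₀≡1 =
  subst (λ d → tail x ↦⟨ consume d (matrix cayley) ⟩ y) x₀≡1 (↦-consume R)

cayley-read-2 : ∀ {x y} → IsCF x → IsCF y → x ↦⟨ matrix cayley ⟩ y → x 0 ≡ + 2 →
  y 0 ≡ + 2 × tail x ↦⟨ matrix cayley ⟩ tail y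
cayley-read-2 {x} {y} hx hy R x₀≡2 = ↦-output (+ 2) (IsCF-tail {x} hx) (hx 0) hy
  (subst (λ d → tail x ↦⟨ consume d (matrix cayley) ⟩ y) x₀≡2 (↦-consume R))
  (negative 0 (- + 1) refl refl ℤ.≤-refl) (zero 1 refl refl)

cayley-read-big : ∀ {x y} → IsCF x → IsCF y → x ↦⟨ matrix cayley ⟩ y → + 3 ≤ x 0 →
  y 0 ≡ + 1 × tail x ↦⟨ halving (x 0 - + 1) ⟩ tail y
cayley-read-big {x} {y} hx hy R = read (x 0) (↦-consume R)
  where
  read : ∀ d → tail x ↦⟨ consume d (matrix cayley) ⟩ y → + 3 ≤ d →
    y 0 ≡ + 1 × tail x ↦⟨ halving (d - + 1) ⟩ tail y
  read d R' 3≤d = proj₁ out ,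
    ↦-cast (proj₂ out) (solve (d ∷ [])) refl (solve (d ∷ [])) (solve (d ∷ []))
    where
    out = ↦-output (+ 1) (IsCF-tail {x} hx) (hx 0) hy R'
            (negative 1 (+ 0) (solve (d ∷ [])) refl -≤+)
            (nonPositive (+ 3 - d) (solve (d ∷ [])) refl (ℤ.i≤j⇒i-j≤0 3≤d))

ValueScaled⇒·⟦⟧< : ∀ {a b} → IsCF a → IsCF b → ValueScaled b 2 a → ∀ n m →
  (- + suc n) ·⟦ b ⟧< - m ⇔ (- (+ 2 * + suc n)) ·⟦ a ⟧< - m
ValueScaled⇒·⟦⟧< {a} {b} ha hb V n m = mk⇔
  (λ below → BelowScaled⇒·⟦⟧< 2 m (suc n) ha (Equivalence.to (V m (suc n) (s≤s z≤n))
    (·⟦⟧<⇒BelowScaled 1 m (suc n) (·⟦⟧<-cong (cong -_ (sym (ℤ.*-identityˡ (+ suc n)))) refl below))))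
  (λ below → ·⟦⟧<-cong (cong -_ (ℤ.*-identityˡ (+ suc n))) refl
    (BelowScaled⇒·⟦⟧< 1 m (suc n) hb (Equivalence.from (V m (suc n) (s≤s z≤n))
      (·⟦⟧<⇒BelowScaled 2 m (suc n) below))))

doubling-start : ∀ {a b} → IsCF a → IsCF b → ValueScaled b 2 a → a ↦⟨ matrix twice ⟩ b
doubling-start {a} {b} ha hb V = maps compare
  where
  coefficient : ∀ u v → u * + 2 - v * + 0 ≡ + 2 * u
  coefficient = solve-∀
  bound : ∀ u v → v * + 1 - u * + 0 ≡ v
  bound = solve-∀
  negate : ∀ d → + 2 * - d ≡ - (+ 2 * d)
  negate = solve-∀
  compare : ∀ u v → (u * + 2 - v * + 0) ·⟦ a ⟧< (v * + 1 - u * + 0) → u ·⟦ b ⟧< v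
  compare -[1+ n ] v below = ·⟦⟧<-cong refl (ℤ.neg-involutive v)
    (Equivalence.from (ValueScaled⇒·⟦⟧< ha hb V n (- v))
      (·⟦⟧<-cong (trans (coefficient -[1+ n ] v) (negate (+ suc n)))
                 (trans (bound -[1+ n ] v) (sym (ℤ.neg-involutive v))) below))
  compare (+ zero) v below =
    0·⟦⟧< hb (0·⟦⟧<⁻¹ ha (·⟦⟧<-cong (coefficient (+ 0) v) (bound (+ 0) v) below))
  compare (+ suc n) v below with ·⟦⟧<-dichotomy hb n v
  ... | inj₁ done = done
  ... | inj₂ above = ⊥-elim (·⟦⟧<-asym (·⟦⟧<-cong (coefficient (+ suc n) v) (bound (+ suc n) v) below)
          (·⟦⟧<-cong (sym (negate (+ suc n))) refl (Equivalence.to (ValueScaled⇒·⟦⟧< ha hb V n v) above)))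

-- Runs of the transducer, tracking the parities of the denominators q

-- (q (i-2) , q (i-1)), with q (-2) = 1 and q (-1) = 0
qBefore : (ℕ → ℤ) → ℕ → ℤ × ℤ
qBefore a zero = + 1 , + 0
qBefore a (suc i) = qPair a i

qBefore-suc : ∀ a i → qBefore a (suc i) ≡ recurrence (a i) (qBefore a i)
qBefore-suc a zero = cong (λ z → + 0 , z + + 1) (sym (ℤ.*-zeroʳ (a 0)))
qBefore-suc a (suc i) = refl

Parities : State → ℤ × ℤ → Set
Parities twice      (Q' , Q) = Even Q × Odd Q'
Parities twice+1    (Q' , Q) = Even Q × Odd Q'
Parities (offset k) (Q' , Q) = Odd Q × Even Q'
Parities cayley     (Q' , Q) = Odd Q × Odd Q'

data DigitCase (d : ℤ) : Set where
  one    : d ≡ + 1 → DigitCase d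
  two    : d ≡ + 2 → DigitCase d
  odd≥3  : ∀ c → + 1 ≤ c → d ≡ + 2 * c + + 1 → DigitCase d
  even≥4 : ∀ c → + 1 ≤ c → d ≡ + 2 * c + + 2 → DigitCase d

digit-case : ∀ {d} → + 1 ≤ d → DigitCase d
digit-case (+≤+ {n = 1} _) = one refl
digit-case (+≤+ {n = 2} _) = two refl
digit-case (+≤+ {n = suc (suc (suc m))} _) with half m
... | t , inj₁ refl =
  odd≥3 (+ t + + 1) (+≤+ (ℕ.m≤n+m 1 t)) (trans (cong (λ z → + 3 + z) (double-ℤ t)) (odd (+ t)))
  where
  odd : ∀ T → + 3 + + 2 * T ≡ + 2 * (T + + 1) + + 1
  odd = solve-∀
... | t , inj₂ refl =
  even≥4 (+ t + + 1) (+≤+ (ℕ.m≤n+m 1 t)) (trans (cong (λ z → + 4 + z) (double-ℤ t)) (even (+ t)))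
  where
  even : ∀ T → + 4 + + 2 * T ≡ + 2 * (T + + 1) + + 2
  even = solve-∀

-- Each digit read raises the potential lag σ + 3 j by at least one, so the output index j
-- keeps pace with the input index i.
lag : State → ℕ
lag twice      = 1
lag twice+1    = 1
lag (offset _) = 2
lag cayley     = 0

lag≤2 : ∀ σ → lag σ ≤ℕ 2
lag≤2 twice      = s≤s z≤n
lag≤2 twice+1    = s≤s z≤n
lag≤2 (offset _) = ℕ.≤-refl
lag≤2 cayley     = z≤n

LimsupLe-from : ∀ {x c} N → (∀ t → x (t ℕ.+ N) ≤ c) → LimsupLe x c
LimsupLe-from {x} {c} N bound = N , eventually-bounded
  where
  eventually-bounded : ∀ m → N ≤ℕ m → x m ≤ c
  eventually-bounded m N≤m = subst (λ i → x i ≤ c) (ℕ.m∸n+n≡m N≤m) (bound (m ℕ.∸ N))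

two-one≤2 : ∀ {x : ℕ → ℤ} {J} → (∀ s → x (double s ℕ.+ J) ≡ + 2 × x (suc (double s ℕ.+ J)) ≡ + 1) →
  ∀ t → x (t ℕ.+ J) ≤ + 2
two-one≤2 digits t with half t
... | s , inj₁ refl = ℤ.≤-reflexive (proj₁ (digits s))
... | s , inj₂ refl = ℤ.≤-trans (ℤ.≤-reflexive (proj₂ (digits s))) (+≤+ (s≤s z≤n))

module Run {a b : ℕ → ℤ} (ha : IsCF a) (hb : IsCF b) (start : a ↦⟨ matrix twice ⟩ b) where

  record Reach (i j : ℕ) (σ : State) : Set where
    constructor reach
    field
      relation : drop i a ↦⟨ matrix σ ⟩ drop j b
      parities : Parities σ (qBefore a i)

  private
    parities-suc : ∀ i σ → Parities σ (recurrence (a i) (qBefore a i)) → Parities σ (qBefore a (suc i))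
    parities-suc i σ = subst (Parities σ) (sym (qBefore-suc a i))

    head-a : ∀ i {d} → a i ≡ d → drop i a 0 ≡ d
    head-a i = trans (drop-head i a)

    head-b : ∀ j {t} → drop j b 0 ≡ t → b j ≡ t
    head-b j = trans (sym (drop-head j b))

    cf-a : ∀ i → IsCF (drop i a)
    cf-a i = IsCF-drop i ha

    cf-b : ∀ j → IsCF (drop j b)
    cf-b j = IsCF-drop j hb

  reach-twice : ∀ {i j} → Reach i j twice → Reach (suc i) j (offset (+ 2 * a i))
  reach-twice {i} {j} (reach R (evenQ , oddQ')) =
    reach (subst (λ d → drop (suc i) a ↦⟨ matrix (offset (+ 2 * d)) ⟩ drop j b) (drop-head i a) (twice-read R))
    (parities-suc i (offset (+ 2 * a i)) (any*even+odd {A = a i} evenQ oddQ' , evenQ))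

  reach-twice+1 : ∀ {i j} → Reach i j twice+1 → Reach (suc i) j (offset (+ 2 * a i + + 1))
  reach-twice+1 {i} {j} (reach R (evenQ , oddQ')) =
    reach (subst (λ d → drop (suc i) a ↦⟨ matrix (offset (+ 2 * d + + 1)) ⟩ drop j b) (drop-head i a)
             (twice+1-read R))
    (parities-suc i (offset (+ 2 * a i + + 1)) (any*even+odd {A = a i} evenQ oddQ' , evenQ))

  reach-offset-1 : ∀ {i j k} → Reach i j (offset k) → a i ≡ + 1 →
    b j ≡ k + + 1 × Reach (suc i) (suc j) cayley
  reach-offset-1 {i} {j} {k} (reach R (oddQ , evenQ')) aᵢ≡1 =
    head-b j (proj₁ out) , reach (proj₂ out)
    (parities-suc i cayley (odd*odd+even (subst Odd (sym aᵢ≡1) (+ 0 , refl)) oddQ evenQ' , oddQ))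
    where out = offset-read-1 k (cf-a i) (cf-b j) R (head-a i aᵢ≡1)

  reach-offset-even : ∀ {i j k c} → Reach i j (offset k) → a i ≡ + 2 * c → + 1 ≤ c →
    b j ≡ k × b (suc j) ≡ c × Reach (suc i) (suc (suc j)) twice
  reach-offset-even {i} {j} {k} {c} (reach R (oddQ , evenQ')) aᵢ≡2c 1≤c =
    head-b j (proj₁ out) , head-b (suc j) (proj₁ out') , reach (proj₂ out')
    (parities-suc i twice (even*odd+even (c , aᵢ≡2c) oddQ evenQ' , oddQ))
    where
    out = offset-read-big k (cf-a i) (cf-b j) R
            (subst (+ 2 ≤_) (sym (head-a i aᵢ≡2c)) (ℤ.*-monoˡ-≤-nonNeg (+ 2) 1≤c))
    out' = halving-even c (cf-a (suc i)) (cf-a i 0) (cf-b (suc j))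
             (subst (λ m → drop (suc i) a ↦⟨ halving m ⟩ drop (suc j) b) (head-a i aᵢ≡2c) (proj₂ out))

  reach-offset-odd : ∀ {i j k c} → Reach i j (offset k) → a i ≡ + 2 * c + + 1 → + 1 ≤ c →
    b j ≡ k × b (suc j) ≡ c × b (suc (suc j)) ≡ + 1 × Reach (suc i) (suc (suc (suc j))) cayley
  reach-offset-odd {i} {j} {k} {c} (reach R (oddQ , evenQ')) aᵢ≡2c+1 1≤c =
    head-b j (proj₁ out) , head-b (suc j) (proj₁ out') , head-b (suc (suc j)) (proj₁ (proj₂ out')) ,
    reach (proj₂ (proj₂ out'))
    (parities-suc i cayley (odd*odd+even (c , aᵢ≡2c+1) oddQ evenQ' , oddQ))
    where
    out = offset-read-big k (cf-a i) (cf-b j) R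
            (subst (+ 2 ≤_) (sym (head-a i aᵢ≡2c+1))
              (ℤ.≤-trans (ℤ.*-monoˡ-≤-nonNeg (+ 2) 1≤c) (ℤ.i≤i+j _ (+ 1))))
    out' = halving-odd c (cf-a (suc i)) (cf-a i 0) (cf-b (suc j))
             (subst (λ m → drop (suc i) a ↦⟨ halving m ⟩ drop (suc j) b) (head-a i aᵢ≡2c+1) (proj₂ out))

  reach-cayley-1 : ∀ {i j} → Reach i j cayley → a i ≡ + 1 → Reach (suc i) j twice+1
  reach-cayley-1 {i} {j} (reach R (oddQ , oddQ')) aᵢ≡1 =
    reach (cayley-read-1 R (head-a i aᵢ≡1))
    (parities-suc i twice+1 (odd*odd+odd (subst Odd (sym aᵢ≡1) (+ 0 , refl)) oddQ oddQ' , oddQ))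

  reach-cayley-2 : ∀ {i j} → Reach i j cayley → a i ≡ + 2 → b j ≡ + 2 × Reach (suc i) (suc j) cayley
  reach-cayley-2 {i} {j} (reach R (oddQ , oddQ')) aᵢ≡2 =
    head-b j (proj₁ out) , reach (proj₂ out)
    (parities-suc i cayley (even*odd+odd (subst Even (sym aᵢ≡2) (+ 1 , refl)) oddQ oddQ' , oddQ))
    where out = cayley-read-2 (cf-a i) (cf-b j) R (head-a i aᵢ≡2)

  reach-cayley-odd : ∀ {i j c} → Reach i j cayley → a i ≡ + 2 * c + + 1 → + 1 ≤ c →
    b j ≡ + 1 × b (suc j) ≡ c × Reach (suc i) (suc (suc j)) twice
  reach-cayley-odd {i} {j} {c} (reach R (oddQ , oddQ')) aᵢ≡2c+1 1≤c =
    head-b j (proj₁ out) , head-b (suc j) (proj₁ out') , reach (proj₂ out')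
    (parities-suc i twice (odd*odd+odd (c , aᵢ≡2c+1) oddQ oddQ' , oddQ))
    where
    out = cayley-read-big (cf-a i) (cf-b j) R
            (subst (+ 3 ≤_) (sym (head-a i aᵢ≡2c+1))
              (ℤ.+-monoˡ-≤ (+ 1) (ℤ.*-monoˡ-≤-nonNeg (+ 2) 1≤c)))
    out' = halving-even c (cf-a (suc i)) (cf-a i 0) (cf-b (suc j))
             (subst (λ m → drop (suc i) a ↦⟨ halving m ⟩ drop (suc j) b)
               (trans (cong (ℤ._- + 1) (head-a i aᵢ≡2c+1)) (solve (c ∷ []))) (proj₂ out))

  reach-cayley-even : ∀ {i j c} → Reach i j cayley → a i ≡ + 2 * c + + 2 → + 1 ≤ c →
    b j ≡ + 1 × b (suc j) ≡ c × b (suc (suc j)) ≡ + 1 × Reach (suc i) (suc (suc (suc j))) cayley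
  reach-cayley-even {i} {j} {c} (reach R (oddQ , oddQ')) aᵢ≡2c+2 1≤c =
    head-b j (proj₁ out) , head-b (suc j) (proj₁ out') , head-b (suc (suc j)) (proj₁ (proj₂ out')) ,
    reach (proj₂ (proj₂ out'))
    (parities-suc i cayley (even*odd+odd (c ℤ.+ + 1 , trans aᵢ≡2c+2 (solve (c ∷ []))) oddQ oddQ' , oddQ))
    where
    out = cayley-read-big (cf-a i) (cf-b j) R
            (subst (+ 3 ≤_) (sym (head-a i aᵢ≡2c+2))
              (ℤ.≤-trans (+≤+ (ℕ.n≤1+n 3)) (ℤ.+-monoˡ-≤ (+ 2) (ℤ.*-monoˡ-≤-nonNeg (+ 2) 1≤c))))
    out' = halving-odd c (cf-a (suc i)) (cf-a i 0) (cf-b (suc j))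
             (subst (λ m → drop (suc i) a ↦⟨ halving m ⟩ drop (suc j) b)
               (trans (cong (ℤ._- + 1) (head-a i aᵢ≡2c+2)) (solve (c ∷ []))) (proj₂ out))

  Progress : ℕ → Set
  Progress i = ∃[ j ] ∃[ σ ] (Reach i j σ × i ≤ℕ lag σ ℕ.+ j ℕ.* 3)

  private
    raise : ∀ {i} σ j m → i ≤ℕ lag σ ℕ.+ j ℕ.* 3 → T (suc (lag σ) ℕ.≤ᵇ m) →
      suc i ≤ℕ m ℕ.+ j ℕ.* 3
    raise σ j m bound l<m = ℕ.≤-trans (s≤s bound) (ℕ.+-monoˡ-≤ (j ℕ.* 3) (ℕ.≤ᵇ⇒≤ (suc (lag σ)) m l<m))

  step : ∀ {i} → + 1 ≤ a i → Progress i → Progress (suc i)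
  step {i} _ (j , twice , R , bound) = j , offset (+ 2 * a i) , reach-twice R , raise twice j 2 bound _
  step {i} _ (j , twice+1 , R , bound) = j , offset (+ 2 * a i + + 1) , reach-twice+1 R , raise twice+1 j 2 bound _
  step 1≤aᵢ (j , offset k , R , bound) with digit-case 1≤aᵢ
  ... | one e = suc j , cayley , proj₂ (reach-offset-1 R e) , raise (offset k) j 3 bound _
  ... | two e = suc (suc j) , twice ,
          proj₂ (proj₂ (reach-offset-even R e ℤ.≤-refl)) , raise (offset k) j 7 bound _
  ... | odd≥3 c 1≤c e = suc (suc (suc j)) , cayley ,
          proj₂ (proj₂ (proj₂ (reach-offset-odd R e 1≤c))) , raise (offset k) j 9 bound _
  ... | even≥4 c 1≤c e = suc (suc j) , twice ,
          proj₂ (proj₂ (reach-offset-even {c = c + + 1} R (trans e (solve (c ∷ []))) (ℤ.≤-trans 1≤c (ℤ.i≤i+j c (+ 1))))) ,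
          raise (offset k) j 7 bound _
  step 1≤aᵢ (j , cayley , R , bound) with digit-case 1≤aᵢ
  ... | one e = j , twice+1 , reach-cayley-1 R e , raise cayley j 1 bound _
  ... | two e = suc j , cayley , proj₂ (reach-cayley-2 R e) , raise cayley j 3 bound _
  ... | odd≥3 c 1≤c e = suc (suc j) , twice ,
          proj₂ (proj₂ (reach-cayley-odd R e 1≤c)) , raise cayley j 7 bound _
  ... | even≥4 c 1≤c e = suc (suc (suc j)) , cayley ,
          proj₂ (proj₂ (proj₂ (reach-cayley-even R e 1≤c))) , raise cayley j 9 bound _

  run : ∀ i → Progress (suc i)
  run zero = 0 , offset (+ 2 * a 0) , reach-twice (reach start ((+ 0 , refl) , (+ 0 , refl))) , s≤s z≤n
  run (suc i) = step (ha i) (run i)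

  cayley-on-twos : ∀ {i j} → Reach i j cayley → (∀ t → a (t ℕ.+ i) ≡ + 2) →
    ∀ t → b (t ℕ.+ j) ≡ + 2 × Reach (suc t ℕ.+ i) (suc t ℕ.+ j) cayley
  cayley-on-twos R twos zero = reach-cayley-2 R (twos 0)
  cayley-on-twos R twos (suc t) = reach-cayley-2 (proj₂ (cayley-on-twos R twos t)) (twos (suc t))

  reach-twice-1-2 : ∀ {i j} → Reach i j twice → a i ≡ + 1 → a (suc i) ≡ + 2 →
    b j ≡ + 2 × b (suc j) ≡ + 1 × Reach (suc (suc i)) (suc (suc j)) twice
  reach-twice-1-2 R aᵢ≡1 aᵢ₊₁≡2 = trans (proj₁ out) (cong (+ 2 *_) aᵢ≡1) , proj₂ out
    where out = reach-offset-even (reach-twice R) aᵢ₊₁≡2 ℤ.≤-refl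

  twice-on-one-two : ∀ {i j} → Reach i j twice →
    (∀ s → a (double s ℕ.+ i) ≡ + 1 × a (suc (double s ℕ.+ i)) ≡ + 2) →
    ∀ s → b (double s ℕ.+ j) ≡ + 2 × b (suc (double s ℕ.+ j)) ≡ + 1 ×
          Reach (double (suc s) ℕ.+ i) (double (suc s) ℕ.+ j) twice
  twice-on-one-two R digits zero = reach-twice-1-2 R (proj₁ (digits 0)) (proj₂ (digits 0))
  twice-on-one-two R digits (suc s) =
    reach-twice-1-2 (proj₂ (proj₂ (twice-on-one-two R digits s)))
      (proj₁ (digits (suc s))) (proj₂ (digits (suc s)))

  bounded-of-shape1 : ∀ n → Shape1 a n → LimsupLe a (+ 2) × LimsupLe b (+ 2)
  bounded-of-shape1 n (twos , q-odd , qPrev-odd) =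
    LimsupLe-from (suc n) (λ t → ℤ.≤-reflexive (twos′ t)) ,
    LimsupLe-from j (λ t → ℤ.≤-reflexive (proj₁ (cayley-on-twos (only-cayley R) twos′ t)))
    where
    twos′ : ∀ t → a (t ℕ.+ suc n) ≡ + 2
    twos′ t = trans (cong a (trans (ℕ.+-comm t (suc n)) (sym (ℕ.+-suc n t)))) (twos t)
    j = proj₁ (run n)
    σ = proj₁ (proj₂ (run n))
    R : Reach (suc n) j σ
    R = proj₁ (proj₂ (proj₂ (run n)))
    only-cayley : ∀ {σ} → Reach (suc n) j σ → Reach (suc n) j cayley
    only-cayley {twice} (reach _ (evenQ , _)) = ⊥-elim (q-odd (even⇒2∣ evenQ))
    only-cayley {twice+1} (reach _ (evenQ , _)) = ⊥-elim (q-odd (even⇒2∣ evenQ))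
    only-cayley {offset _} (reach _ (_ , evenQ')) = ⊥-elim (qPrev-odd (even⇒2∣ evenQ'))
    only-cayley {cayley} R = R

  bounded-of-shape2 : ∀ n → Shape2 a n → LimsupLe a (+ 2) × LimsupLe b (+ 2)
  bounded-of-shape2 n (periodic , qPrev-even) =
    LimsupLe-from (suc n) (two-one≤2 {a} two-one) ,
    LimsupLe-from (suc (suc j)) (two-one≤2 {b} (λ s → proj₁ (loop s) , proj₁ (proj₂ (loop s))))
    where
    index : ∀ n s → s ℕ.* 2 ℕ.+ suc n ≡ n ℕ.+ suc (2 ℕ.* s)
    index = ℕ-Solver.solve-∀
    two-one : ∀ s → a (double s ℕ.+ suc n) ≡ + 2 × a (suc (double s ℕ.+ suc n)) ≡ + 1
    two-one s = trans (cong a position) (proj₁ (periodic s)) ,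
                trans (cong a (trans (cong suc position) (sym (ℕ.+-suc n (suc (2 ℕ.* s)))))) (proj₂ (periodic s))
      where
      position : double s ℕ.+ suc n ≡ n ℕ.+ suc (2 ℕ.* s)
      position = trans (cong (ℕ._+ suc n) (trans (double≡2* s) (ℕ.*-comm 2 s))) (index n s)
    j = proj₁ (run n)
    σ = proj₁ (proj₂ (run n))
    R : Reach (suc n) j σ
    R = proj₁ (proj₂ (proj₂ (run n)))
    only-offset : ∀ {σ} → Reach (suc n) j σ → ∃[ k ] Reach (suc n) j (offset k)
    only-offset {twice} (reach _ (_ , oddQ')) = ⊥-elim (even⇒¬odd (2∣⇒even qPrev-even) oddQ')
    only-offset {twice+1} (reach _ (_ , oddQ')) = ⊥-elim (even⇒¬odd (2∣⇒even qPrev-even) oddQ')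
    only-offset {cayley} (reach _ (_ , oddQ')) = ⊥-elim (even⇒¬odd (2∣⇒even qPrev-even) oddQ')
    only-offset {offset k} R = k , R
    R₂ : Reach (suc (suc n)) (suc (suc j)) twice
    R₂ = proj₂ (proj₂ (reach-offset-even (proj₂ (only-offset R)) (proj₁ (two-one 0)) ℤ.≤-refl))
    loop = twice-on-one-two R₂ λ s →
      trans (cong a (ℕ.+-suc (double s) (suc n))) (proj₂ (two-one s)) ,
      trans (cong a (cong suc (ℕ.+-suc (double s) (suc n)))) (proj₁ (two-one (suc s)))

  module Bounded (N₁ : ℕ) (small-a : ∀ n → N₁ ≤ℕ n → a n ≤ + 2)
                 (N₂ : ℕ) (small-b : ∀ n → N₂ ≤ℕ n → b n ≤ + 2) where

    Late : ℕ → ℕ → Set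
    Late i j = suc N₁ ≤ℕ i × N₂ ≤ℕ j

    later : ∀ {i j} m n → Late i j → Late (m ℕ.+ i) (n ℕ.+ j)
    later m n (i-late , j-late) = ℕ.≤-trans i-late (ℕ.m≤n+m _ m) , ℕ.≤-trans j-late (ℕ.m≤n+m _ n)

    late-digit : ∀ {i j} → Late i j → a i ≡ + 1 ⊎ a i ≡ + 2
    late-digit {suc i} (s≤s N₁≤i , _) = one-or-two (ha i) (small-a (suc i) (ℕ.m≤n⇒m≤1+n N₁≤i))

    late-digit-pos : ∀ {i j} → Late i j → + 1 ≤ a i
    late-digit-pos {suc i} _ = ha i

    no-large-offset : ∀ {i j k} → Late i j → Reach i j (offset k) → + 3 ≤ k → ⊥
    no-large-offset {i} {j} {k} late R 3≤k with late-digit late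
    ... | inj₁ aᵢ≡1 = 3≤⇒≰2 (ℤ.≤-trans 3≤k (ℤ.i≤i+j k (+ 1)))
                        (subst (_≤ + 2) (proj₁ (reach-offset-1 R aᵢ≡1)) (small-b j (proj₂ late)))
    ... | inj₂ aᵢ≡2 =
      3≤⇒≰2 3≤k (subst (_≤ + 2) (proj₁ (reach-offset-even R aᵢ≡2 ℤ.≤-refl)) (small-b j (proj₂ late)))

    no-twice+1 : ∀ {i j} → Late i j → Reach i j twice+1 → ⊥
    no-twice+1 late R = no-large-offset (later 1 0 late) (reach-twice+1 R)
      (ℤ.+-monoˡ-≤ (+ 1) (ℤ.*-monoˡ-≤-nonNeg (+ 2) (late-digit-pos late)))

    late-cayley : ∀ {i j} → Late i j → Reach i j cayley → a i ≡ + 2 × Reach (suc i) (suc j) cayley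
    late-cayley late R with late-digit late
    ... | inj₁ aᵢ≡1 = ⊥-elim (no-twice+1 (later 1 0 late) (reach-cayley-1 R aᵢ≡1))
    ... | inj₂ aᵢ≡2 = aᵢ≡2 , proj₂ (reach-cayley-2 R aᵢ≡2)

    late-twice : ∀ {i j} → Late i j → Reach i j twice →
      a i ≡ + 1 × a (suc i) ≡ + 2 × Reach (suc (suc i)) (suc (suc j)) twice
    late-twice {i} {j} late R with late-digit (later 1 0 late)
    ... | inj₁ aᵢ₊₁≡1 = ⊥-elim (3≤⇒≰2 (ℤ.+-monoˡ-≤ (+ 1) (ℤ.*-monoˡ-≤-nonNeg (+ 2) (late-digit-pos late)))
      (subst (_≤ + 2) (proj₁ (reach-offset-1 (reach-twice R) aᵢ₊₁≡1)) (small-b j (proj₂ late))))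
    ... | inj₂ aᵢ₊₁≡2 = only-one (late-digit late)
      where
      out = reach-offset-even (reach-twice R) aᵢ₊₁≡2 ℤ.≤-refl
      only-one : a i ≡ + 1 ⊎ a i ≡ + 2 →
        a i ≡ + 1 × a (suc i) ≡ + 2 × Reach (suc (suc i)) (suc (suc j)) twice
      only-one (inj₁ aᵢ≡1) = aᵢ≡1 , aᵢ₊₁≡2 , proj₂ (proj₂ out)
      only-one (inj₂ aᵢ≡2) = ⊥-elim (3≤⇒≰2
        (ℤ.≤-trans (+≤+ (ℕ.n≤1+n 3)) (ℤ.≤-reflexive (sym (trans (proj₁ out) (cong (+ 2 *_) aᵢ≡2)))))
                                       (small-b j (proj₂ late)))

    late-offset : ∀ {i j k} → Late i j → Reach i j (offset k) →
      Reach (suc i) (suc j) cayley ⊎ Reach (suc i) (suc (suc j)) twice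
    late-offset late R with late-digit late
    ... | inj₁ aᵢ≡1 = inj₁ (proj₂ (reach-offset-1 R aᵢ≡1))
    ... | inj₂ aᵢ≡2 = inj₂ (proj₂ (proj₂ (reach-offset-even R aᵢ≡2 ℤ.≤-refl)))

    cayley-twos : ∀ {i j} → Late i j → Reach i j cayley → ∀ t → a (t ℕ.+ i) ≡ + 2
    cayley-twos late R zero = proj₁ (late-cayley late R)
    cayley-twos {i} late R (suc t) =
      trans (cong a (sym (ℕ.+-suc t i))) (cayley-twos (later 1 1 late) (proj₂ (late-cayley late R)) t)

    twice-one-two : ∀ {i j} → Late i j → Reach i j twice →
      ∀ s → a (double s ℕ.+ i) ≡ + 1 × a (suc (double s ℕ.+ i)) ≡ + 2
    twice-one-two late R zero = proj₁ (late-twice late R) , proj₁ (proj₂ (late-twice late R))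
    twice-one-two {i} late R (suc s) =
      trans (cong a (shift (double s))) (proj₁ next) , trans (cong a (cong suc (shift (double s)))) (proj₂ next)
      where
      next = twice-one-two (later 2 2 late) (proj₂ (proj₂ (late-twice late R))) s
      shift : ∀ m → suc (suc m) ℕ.+ i ≡ m ℕ.+ suc (suc i)
      shift m = sym (trans (ℕ.+-suc m (suc i)) (cong suc (ℕ.+-suc m i)))

    shape1 : ∀ {n j} → Late (suc n) j → Reach (suc n) j cayley → Shape1 a n
    shape1 {n} late R = (λ t → trans (cong a (position t)) (cayley-twos late R t)) ,
                        odd⇒¬2∣ (proj₁ (Reach.parities R)) , odd⇒¬2∣ (proj₂ (Reach.parities R))
      where
      position : ∀ t → n ℕ.+ suc t ≡ t ℕ.+ suc n
      position t = trans (ℕ.+-suc n t) (trans (cong suc (ℕ.+-comm n t)) (sym (ℕ.+-suc t n)))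

    shape2 : ∀ {n j} → Late (suc n) j → Reach (suc n) j twice → Shape2 a (suc n)
    shape2 {n} late R = (λ s → trans (cong a (position₁ s)) (proj₂ (twice-one-two late R s)) ,
                               trans (cong a (position₂ s)) (proj₁ (twice-one-two late R (suc s)))) ,
                        even⇒2∣ (proj₁ (Reach.parities R))
      where
      index : ∀ n s → suc n ℕ.+ suc (s ℕ.* 2) ≡ suc (s ℕ.* 2 ℕ.+ suc n)
      index = ℕ-Solver.solve-∀
      2*≡double : ∀ s → 2 ℕ.* s ≡ double s
      2*≡double s = sym (double≡2* s)
      position₁ : ∀ s → suc n ℕ.+ suc (2 ℕ.* s) ≡ suc (double s ℕ.+ suc n)
      position₁ s = trans (cong (λ m → suc n ℕ.+ suc m) (ℕ.*-comm 2 s))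
                      (trans (index n s) (cong (λ m → suc (m ℕ.+ suc n)) (trans (ℕ.*-comm s 2) (2*≡double s))))
      position₂ : ∀ s → suc n ℕ.+ suc (suc (2 ℕ.* s)) ≡ double (suc s) ℕ.+ suc n
      position₂ s = trans (ℕ.+-suc (suc n) (suc (2 ℕ.* s))) (cong suc (position₁ s))

    shape : ∃[ n ] (Shape1 a n ⊎ Shape2 a n)
    shape = from-state σ (proj₁ (proj₂ (proj₂ progress)))
      where
      progress = run (N₂ ℕ.* 3 ℕ.+ N₁)
      j = proj₁ progress
      σ = proj₁ (proj₂ progress)
      i₀ = N₂ ℕ.* 3 ℕ.+ N₁
      N₂≤j : N₂ ≤ℕ j
      N₂≤j = ℕ.≤-pred (ℕ.*-cancelʳ-< 3 N₂ (suc j) (ℕ.<-≤-trans (s≤s (ℕ.m≤m+n (N₂ ℕ.* 3) N₁))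
               (ℕ.≤-trans (proj₂ (proj₂ (proj₂ progress)))
                 (ℕ.+-monoˡ-≤ (j ℕ.* 3) (ℕ.≤-trans (lag≤2 σ) (ℕ.n≤1+n 2))))))
      late : Late (suc i₀) j
      late = s≤s (ℕ.m≤n+m N₁ (N₂ ℕ.* 3)) , N₂≤j
      from-state : ∀ σ → Reach (suc i₀) j σ → ∃[ n ] (Shape1 a n ⊎ Shape2 a n)
      from-state twice R = suc i₀ , inj₂ (shape2 late R)
      from-state twice+1 R = ⊥-elim (no-twice+1 late R)
      from-state cayley R = i₀ , inj₁ (shape1 late R)
      from-state (offset k) R =
        [ (λ R' → suc i₀ , inj₁ (shape1 (later 1 1 late) R')) ,
          (λ R' → suc (suc i₀) , inj₂ (shape2 (later 1 2 late) R')) ]′ (late-offset late R)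

theorem7p2 : (a b : ℕ → ℤ) → IsCF a → IsCF b → ValueScaled b 2 a →
    ((LimsupLe a (+ 2) × LimsupLe b (+ 2)) ⇔ (∃[ n ] (Shape1 a n ⊎ Shape2 a n)))
theorem7p2 a b ha hb V = mk⇔ forward backward
  where
  open Run ha hb (doubling-start ha hb V)
  forward : LimsupLe a (+ 2) × LimsupLe b (+ 2) → ∃[ n ] (Shape1 a n ⊎ Shape2 a n)
  forward ((N₁ , small-a) , (N₂ , small-b)) = Bounded.shape N₁ small-a N₂ small-b
  backward : ∃[ n ] (Shape1 a n ⊎ Shape2 a n) → LimsupLe a (+ 2) × LimsupLe b (+ 2)
  backward (n , inj₁ shape) = bounded-of-shape1 n shape
  backward (n , inj₂ shape) = bounded-of-shape2 n shape
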